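{- Let $G$ be a graph without isolated vertices, $B$ a $\wedge_d$-OBDD representing $\psi(G)$ and obeying a linear order $\pi^*$ of $V(G^*)$. Let $U=\{u_1,\dots,u_q\}$, $W=\{w_1,\dots,w_q\}\subseteq V(G)$ be such that $M=\{\{u_1[1],w_1[2]\},\dots,\{u_q[1],w_q[2]\}\}$ is an induced matching of $G^*$ and every element of $U[1]$ precedes every element of $W[2]$ in $\pi^*$. Let $\pi_0$ be the prefix of $\pi^*$ ending with the last element of $U[1]$, and let $\mathcal{F}$, $I({\bf g})$ and ${\bf h}_J[{\bf g}]$ be as defined in the context. Then for every ${\bf g}\in\mathcal{F}$ and every $J\subseteq I({\bf g})$, the assignment ${\bf h}_J[{\bf g}]$ satisfies $\psi(G)$ if and only if $J\neq\emptyset$.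
   Context: $G^*$ is the graph with vertex set $V[1]\cup V[2]$, where $V[i]=\{v[i]:v\in V(G)\}$ are two disjoint copies of $V(G)$, and edges $\{u[1],v[2]\}$, $\{v[1],u[2]\}$ for every edge $\{u,v\}\in E(G)$; $U[i]=\{u[i]:u\in U\}$. $\psi(G)$ is the CNF on variables $V(G^*)$ with a clause $(a\vee b)$ for every edge $\{a,b\}$ of $G^*$ plus the two clauses $\bigvee_{v\in V(G)}\neg v[1]$ and $\bigvee_{v\in V(G)}\neg v[2]$. A matching is induced if there is no edge of the graph between endpoints of distinct matching edges. A $\wedge_d$-OBDD is a read-once decision diagram with decomposable conjunction nodes whose decision-node labels appear in increasing $\pi^*$-order along every path; it represents $\psi(G)$ if it computes exactly this function on $V(G^*)$ (this assumption fixes the setting and is not used in the claim itself beyond defining the objects). Fooling assignments: $\mathcal{F}$ is the set of assignments ${\bf g}$ with domain $\pi_0$ (as a set) such that at least one variable of $U[1]$ is mapped to $0$, at least two variables of $U[1]$ are mapped to $1$, and all variables of $\pi_0\setminus U[1]$ are mapped to $1$. For ${\bf g}\in\mathcal{F}$, $I({\bf g})=\{i\in\{1,\dots,q\}:{\bf g}(u_i[1])=1\}$. For $J\subseteq\{1,\dots,q\}$, $W[2]_J=\{w_j[2]:j\in J\}$. For $J\subseteq I({\bf g})$, ${\bf h}_J[{\bf g}]$ is the assignment to $V(G^*)$ extending ${\bf g}$ that maps each variable outside $\pi_0$ to $0$ if it lies in $W[2]_J$ and to $1$ otherwise (note $W[2]$ is disjoint from $\pi_0$). -}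

module Defs where

open import Data.Nat using (ℕ; _+_; _≤_; _<_)
open import Data.Nat.Properties using (_≤?_)
open import Data.Fin using (Fin; toℕ; _≟_)
open import Data.Fin.Properties using (any?)
open import Data.Bool using (Bool; true; false; _∨_; not)
open import Data.Bool.Properties using () renaming (_≟_ to _≟B_)
open import Data.Empty using (⊥)
open import Data.Sum using (_⊎_; inj₁; inj₂)
open import Data.Product using (Σ; ∃; ∃-syntax; _×_; _,_)
open import Relation.Nullary using (¬_; Dec; yes; no)
open import Relation.Nullary.Decidable using (_×-dec_)
open import Relation.Binary.PropositionalEquality using (_≡_)

record Graph (n : ℕ) : Set where
  field
    adj   : Fin n → Fin n → Bool
    sym   : ∀ u v → adj u v ≡ adj v u
    irrefl : ∀ v → adj v v ≡ false
open Graph public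

NoIsolated : ∀ {n} → Graph n → Set
NoIsolated {n} G = ∀ (v : Fin n) → ∃[ u ] (adj G v u ≡ true)

-- Vertices of G* : inj₁ v = v[1], inj₂ v = v[2].
V* : ℕ → Set
V* n = Fin n ⊎ Fin n

adj* : ∀ {n} → Graph n → V* n → V* n → Bool
adj* G (inj₁ u) (inj₂ v) = adj G u v
adj* G (inj₂ u) (inj₁ v) = adj G u v
adj* G (inj₁ _) (inj₁ _) = false
adj* G (inj₂ _) (inj₂ _) = false

Assignment : ℕ → Set
Assignment n = V* n → Bool

Satisfies-ψ : ∀ {n} → Graph n → Assignment n → Set
Satisfies-ψ {n} G σ =
  (∀ (a b : V* n) → adj* G a b ≡ true → (σ a ∨ σ b) ≡ true)
  × (∃[ v ] (σ (inj₁ v) ≡ false))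
  × (∃[ v ] (σ (inj₂ v) ≡ false))

-- A linear order π* of V(G*), given by a bijective position map
-- (rank x = position of x in π*).  Injectivity on the finite set
-- V(G*) of size n+n into Fin (n+n) makes it a bijection.
record LinearOrder (n : ℕ) : Set where
  field
    rank     : V* n → Fin (n + n)
    rank-inj : ∀ x y → rank x ≡ rank y → x ≡ y
open LinearOrder public

_⊑[_]_ : ∀ {n} → V* n → LinearOrder n → V* n → Set
x ⊑[ π ] y = toℕ (rank π x) ≤ toℕ (rank π y)

_⊏[_]_ : ∀ {n} → V* n → LinearOrder n → V* n → Set
x ⊏[ π ] y = toℕ (rank π x) < toℕ (rank π y)

IsInducedMatching : ∀ {X : Set} {q : ℕ} → (X → X → Bool) →
                    (Fin q → X) → (Fin q → X) → Set
IsInducedMatching {X} {q} H e₁ e₂ =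
  (∀ i → H (e₁ i) (e₂ i) ≡ true)
  × (∀ i j → ¬ (i ≡ j) → ∀ (a b : X) → Endp i a → Endp j b → ¬ (a ≡ b))
  × (∀ i j → ¬ (i ≡ j) → ∀ (a b : X) → Endp i a → Endp j b → H a b ≡ false)
  where
    Endp : Fin q → X → Set
    Endp i a = (a ≡ e₁ i) ⊎ (a ≡ e₂ i)

-- π₀ : the prefix of π* ending with the last element of U[1], i.e. the
-- elements x that do not come after every element of U[1].
Inπ₀ : ∀ {n q} → LinearOrder n → (Fin q → Fin n) → V* n → Set
Inπ₀ π u x = ∃[ i ] (x ⊑[ π ] inj₁ (u i))

Inπ₀? : ∀ {n q} (π : LinearOrder n) (u : Fin q → Fin n) (x : V* n) →
        Dec (Inπ₀ π u x)
Inπ₀? π u x = any? (λ i → toℕ (rank π x) ≤? toℕ (rank π (inj₁ (u i))))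

-- Fooling assignments 𝓕 (an assignment g is only consulted on π₀).
InF : ∀ {n q} → LinearOrder n → (Fin q → Fin n) → Assignment n → Set
InF {n} {q} π u g =
  (∃[ i ] (g (inj₁ (u i)) ≡ false))
  × (∃[ i ] ∃[ j ] (¬ (i ≡ j) × g (inj₁ (u i)) ≡ true × g (inj₁ (u j)) ≡ true))
  × (∀ (x : V* n) → Inπ₀ π u x → ¬ (∃[ i ] (x ≡ inj₁ (u i))) → g x ≡ true)

Subset : ℕ → Set
Subset q = Fin q → Bool

⊆I : ∀ {n q} → (Fin q → Fin n) → Assignment n → Subset q → Set
⊆I u g J = ∀ j → J j ≡ true → g (inj₁ (u j)) ≡ true

InW2J : ∀ {n q} → (Fin q → Fin n) → Subset q → V* n → Set
InW2J w J (inj₁ _) = ⊥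
InW2J w J (inj₂ v) = ∃[ j ] (J j ≡ true × w j ≡ v)

InW2J? : ∀ {n q} (w : Fin q → Fin n) (J : Subset q) (x : V* n) →
         Dec (InW2J w J x)
InW2J? w J (inj₁ _) = no (λ ())
InW2J? w J (inj₂ v) = any? (λ j → (J j ≟B true) ×-dec (w j ≟ v))

h : ∀ {n q} → LinearOrder n → (u w : Fin q → Fin n) → Subset q →
    Assignment n → Assignment n
h π u w J g x with Inπ₀? π u x
... | yes _ = g x
... | no _ with InW2J? w J x
...   | yes _ = false
...   | no _  = true

-- The zeros of h_J[g] are the zeros of g on U[1] together with W[2]_J: the
-- rest of π₀ is set to 1 by g, and the rest of the complement of π₀ to 1 by
-- construction.  These zeros form an independent set of G*: V[1] and V[2]
-- are independent, an edge u_i[1] w_i[2] would need g(u_i[1]) = 0 with i ∈ J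
-- ⊆ I(g), and an edge u_i[1] w_j[2] with i ≠ j is excluded because the
-- matching is induced.  Hence every edge clause holds, the clause over V[1]
-- is witnessed by a zero of g on U[1], and the clause over V[2] holds exactly
-- when W[2]_J, the only source of zeros in V[2], is non-empty.
module Submission where

open import Defs
open import Data.Nat using (ℕ)
open import Data.Nat.Properties using (≤-refl; <⇒≱)
open import Data.Fin using (Fin)
open import Data.Fin.Properties using (any?) renaming (_≟_ to _≟F_)
open import Data.Bool using (Bool; true; false; _∨_)
open import Data.Bool.Properties using (not-¬)
open import Data.Empty using (⊥; ⊥-elim)
open import Data.Sum using (_⊎_; inj₁; inj₂)
open import Data.Sum.Properties using (≡-dec)
open import Data.Product using (∃-syntax; _×_; _,_)
open import Relation.Nullary using (¬_; yes; no)
open import Relation.Binary.PropositionalEquality using (_≡_; refl; trans; ≢-sym)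
open import Function.Bundles using (_⇔_; mk⇔)

edge-clauses-hold : ∀ {X : Set} (H : X → X → Bool) (σ : X → Bool) →
                    (∀ a b → H a b ≡ true → σ a ≡ false → σ b ≡ false → ⊥) →
                    ∀ a b → H a b ≡ true → (σ a ∨ σ b) ≡ true
edge-clauses-hold H σ no-zero-edge a b e with σ a in σa | σ b in σb
... | true  | _     = refl
... | false | true  = refl
... | false | false = ⊥-elim (no-zero-edge a b e σa σb)

module _ {n q : ℕ} (π : LinearOrder n) (u w : Fin q → Fin n)
         (J : Subset q) (g : Assignment n) where

  h-on-π₀ : ∀ x → Inπ₀ π u x → h π u w J g x ≡ g x
  h-on-π₀ x x∈π₀ with Inπ₀? π u x
  ... | yes _    = refl
  ... | no x∉π₀ = ⊥-elim (x∉π₀ x∈π₀)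

  h-on-W[2]J : ∀ x → ¬ Inπ₀ π u x → InW2J w J x → h π u w J g x ≡ false
  h-on-W[2]J x x∉π₀ x∈W with Inπ₀? π u x
  ... | yes x∈π₀ = ⊥-elim (x∉π₀ x∈π₀)
  ... | no _ with InW2J? w J x
  ...   | yes _    = refl
  ...   | no x∉W   = ⊥-elim (x∉W x∈W)

  ZeroOnU[1] : V* n → Set
  ZeroOnU[1] x = ∃[ i ] (x ≡ inj₁ (u i) × g x ≡ false)

  h-zero⇒ : InF π u g → ∀ x → h π u w J g x ≡ false → ZeroOnU[1] x ⊎ InW2J w J x
  h-zero⇒ (_ , _ , g-one-off-U[1]) x hx≡0 with Inπ₀? π u x
  ... | yes x∈π₀ with any? (λ i → ≡-dec _≟F_ _≟F_ x (inj₁ (u i)))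
  ...   | yes (i , x≡uᵢ) = inj₁ (i , x≡uᵢ , hx≡0)
  ...   | no x∉U = ⊥-elim (not-¬ (g-one-off-U[1] x x∈π₀ x∉U) hx≡0)
  h-zero⇒ _ x hx≡0 | no _ with InW2J? w J x
  ...   | yes x∈W = inj₂ x∈W
  h-zero⇒ _ x () | no _ | no _

  zero-of-g-outside-J : ⊆I u g J → ∀ {i j} → J j ≡ true → g (inj₁ (u i)) ≡ false → ¬ i ≡ j
  zero-of-g-outside-J J⊆I Jj gᵢ≡0 refl = not-¬ (J⊆I _ Jj) gᵢ≡0

  zeros-independent : ∀ {G : Graph n} →
                      IsInducedMatching (adj* G) (λ i → inj₁ (u i)) (λ i → inj₂ (w i)) →
                      ⊆I u g J →
                      ∀ a b → adj* G a b ≡ true →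
                      ZeroOnU[1] a ⊎ InW2J w J a → ZeroOnU[1] b ⊎ InW2J w J b → ⊥
  zeros-independent _ _ _ _ () (inj₁ (_ , refl , _)) (inj₁ (_ , refl , _))
  zeros-independent _ _ (inj₂ _) (inj₂ _) () (inj₂ _) (inj₂ _)
  zeros-independent (_ , _ , induced) J⊆I _ (inj₂ _) e (inj₁ (i , refl , gᵢ≡0)) (inj₂ (j , Jj , refl)) =
    not-¬ e (induced i j (zero-of-g-outside-J J⊆I Jj gᵢ≡0) _ _ (inj₁ refl) (inj₂ refl))
  zeros-independent (_ , _ , induced) J⊆I (inj₂ _) _ e (inj₂ (j , Jj , refl)) (inj₁ (i , refl , gᵢ≡0)) =
    not-¬ e (induced j i (≢-sym (zero-of-g-outside-J J⊆I Jj gᵢ≡0)) _ _ (inj₂ refl) (inj₁ refl))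

lemma7 : ∀ {n q : ℕ} (G : Graph n) → NoIsolated G →
         (π : LinearOrder n) (u w : Fin q → Fin n) →
         IsInducedMatching (adj* G) (λ i → inj₁ (u i)) (λ i → inj₂ (w i)) →
         (∀ i j → inj₁ (u i) ⊏[ π ] inj₂ (w j)) →
         ∀ (g : Assignment n) → InF π u g →
         ∀ (J : Subset q) → ⊆I u g J →
         Satisfies-ψ G (h π u w J g) ⇔ (∃[ j ] (J j ≡ true))
lemma7 G _ π u w M U[1]≺W[2] g g∈F@((i , gᵢ≡0) , _) J J⊆I = mk⇔ J-nonempty satisfies
  where
  hJ : Assignment _
  hJ = h π u w J g

  zero⇒ : ∀ x → hJ x ≡ false → ZeroOnU[1] π u w J g x ⊎ InW2J w J x
  zero⇒ = h-zero⇒ π u w J g g∈F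

  J-nonempty : Satisfies-ψ G hJ → ∃[ j ] (J j ≡ true)
  J-nonempty (_ , _ , v , hv[2]≡0) with zero⇒ (inj₂ v) hv[2]≡0
  ... | inj₁ (_ , () , _)
  ... | inj₂ (j , Jj , _) = j , Jj

  satisfies : ∃[ j ] (J j ≡ true) → Satisfies-ψ G hJ
  satisfies (j , Jj) = edge-clauses-hold (adj* G) hJ no-zero-edge
                     , (u i , trans (h-on-π₀ π u w J g _ (i , ≤-refl)) gᵢ≡0)
                     , (w j , h-on-W[2]J π u w J g _ wⱼ[2]∉π₀ (j , Jj , refl))
    where
    no-zero-edge : ∀ a b → adj* G a b ≡ true → hJ a ≡ false → hJ b ≡ false → ⊥
    no-zero-edge a b e ha≡0 hb≡0 =
      zeros-independent π u w J g M J⊆I a b e (zero⇒ a ha≡0) (zero⇒ b hb≡0)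
    wⱼ[2]∉π₀ : ¬ Inπ₀ π u (inj₂ (w j))
    wⱼ[2]∉π₀ (k , w≼u) = <⇒≱ (U[1]≺W[2] k j) w≼u
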